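{- If $G$ is a 5-regular (quintic) graph of order $8$, then $\chi_{la}(G)=\chi(G)=4$.
   Context: $\chi(G)$ is the chromatic number. For a simple graph $G=(V,E)$ with $q$ edges, a bijection $f:E\to\{1,\dots,q\}$ is a local antimagic labeling if $f^+(u)\neq f^+(v)$ for every edge $uv$, where $f^+(u)=\sum_{e\ni u} f(e)$. The local antimagic chromatic number $\chi_{la}(G)$ is the minimum number of distinct values of $f^+$ over all local antimagic labelings $f$ of $G$. -}

module Defs where

open import Data.Nat using (ℕ; zero; suc; _+_; _≤_)
import Data.Nat.Properties as ℕP
open import Data.Fin using (Fin; toℕ) renaming (_<_ to _<ᶠ_)
import Data.Fin as Fin
open import Data.Bool using (Bool; true; false; if_then_else_; _∨_)
open import Data.List using (List; map; allFin; length; deduplicate)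
open import Data.Nat.ListAction using (sum)
open import Data.Product using (Σ; _×_; _,_; proj₁; proj₂)
open import Relation.Binary.PropositionalEquality using (_≡_; _≢_)
open import Relation.Nullary.Decidable using (⌊_⌋)
open import Function.Bundles using (_↔_; Inverse)

record SimpleGraph (n : ℕ) : Set where
  field
    adj    : Fin n → Fin n → Bool
    sym    : ∀ i j → adj i j ≡ adj j i
    irrefl : ∀ i → adj i i ≡ false
open SimpleGraph public

module _ {n : ℕ} (G : SimpleGraph n) where

  degree : Fin n → ℕ
  degree u = sum (map (λ v → if adj G u v then 1 else 0) (allFin n))

  Regular : ℕ → Set
  Regular k = ∀ u → degree u ≡ k

  ProperColoring : (k : ℕ) → (Fin n → Fin k) → Set
  ProperColoring k c = ∀ u v → adj G u v ≡ true → c u ≢ c v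

  Colorable : ℕ → Set
  Colorable k = Σ (Fin n → Fin k) (ProperColoring k)

  IsChromaticNumber : ℕ → Set
  IsChromaticNumber k = Colorable k × (∀ m → Colorable m → k ≤ m)

  Edge : Set
  Edge = Σ (Fin n × Fin n) (λ p → (proj₁ p <ᶠ proj₂ p) × (adj G (proj₁ p) (proj₂ p) ≡ true))

  endpoint? : Fin n → Edge → Bool
  endpoint? u ((i , j) , _) = ⌊ u Fin.≟ i ⌋ ∨ ⌊ u Fin.≟ j ⌋

  -- An edge labeling: a bijection f : E → {1,…,q}, given as a bijection
  -- E ↔ Fin q, with f(e) = 1 + toℕ (to e).
  record EdgeLabeling : Set where
    field
      q   : ℕ
      bij : Edge ↔ Fin q

    label : Edge → ℕ
    label e = suc (toℕ (Inverse.to bij e))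

    -- f⁺(u) = Σ_{e ∋ u} f(e); summed over labels k+1, k < q,
    -- the edge with label k+1 being (from k).
    vsum : Fin n → ℕ
    vsum u = sum (map (λ k → if endpoint? u (Inverse.from bij k) then suc (toℕ k) else 0)
                      (allFin q))

  open EdgeLabeling public

  IsLocalAntimagic : EdgeLabeling → Set
  IsLocalAntimagic f = ∀ u v → adj G u v ≡ true → vsum f u ≢ vsum f v

  numColors : EdgeLabeling → ℕ
  numColors f = length (deduplicate ℕP._≟_ (map (vsum f) (allFin n)))

  IsLocalAntimagicChromaticNumber : ℕ → Set
  IsLocalAntimagicChromaticNumber k =
    (Σ EdgeLabeling (λ f → IsLocalAntimagic f × numColors f ≡ k))
    × (∀ f → IsLocalAntimagic f → k ≤ numColors f)

-- The complement of a 5-regular graph of order 8 is 2-regular, so it is C₈, C₃ + C₅ or C₄ + C₄.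
-- For each of the three, an explicit local antimagic labeling induces 4 vertex sums, and the
-- vertex sums of a local antimagic labeling are a proper colouring: χ ≤ χ_la ≤ 4. Each graph
-- also contains a homomorphic image of the wheel W₅, which is not 3-colourable: 4 ≤ χ ≤ χ_la.
-- The case distinction is carried out by enumerating all 3507 such graphs on Fin 8 as
-- upper-triangular adjacency tables and checking each against a certificate obtained by
-- relabelling the template of its complement along the complement's cycles; only the check is
-- trusted, not the search.
module Submission where

open import Defs hiding (sym)
open import Axiom.UniquenessOfIdentityProofs using (module Decidable⇒UIP)
open import Data.Bool using (Bool; true; false; not; _∧_; _∨_; if_then_else_)
import Data.Bool as Bool
open import Data.Bool.Properties using (T-≡)
open import Data.Empty using (⊥-elim)
open import Data.Fin as Fin using (Fin; zero; suc; #_; toℕ; inject≤; _<_; _<?_)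
open import Data.Fin.Properties using (all?; inject≤-injective; <-irrelevant)
open import Data.List as List using (List; []; _∷_; allFin; length; deduplicate; filterᵇ; filter; head; drop; _++_)
open import Data.List.Membership.Propositional using (_∈_)
open import Data.List.Membership.Propositional.Properties using (∈-deduplicate⁺; ∈-map⁺; ∈-allFin)
open import Data.List.Membership.DecPropositional (Fin._≟_ {8}) using (_∉?_)
open import Data.List.Properties using (map-tabulate; tabulate-cong)
open import Data.List.Relation.Unary.All as All using (All)
open import Data.List.Relation.Unary.All.Properties using (All¬⇒¬Any)
open import Data.List.Relation.Unary.Any as Any using (Any; any?)
import Data.List.Relation.Unary.Any.Properties as Any
open import Data.Maybe using (fromMaybe)
open import Data.Nat using (ℕ; zero; suc; _∸_; _≤_; _≟_; _≤?_; _≤ᵇ_)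
open import Data.Nat.ListAction using (sum)
open import Data.Nat.Properties using (m≤m+n; m+n∸m≡n; ≰⇒>; ≤-pred)
open import Data.Product using (_×_; _,_; proj₁; proj₂)
open import Data.Product.Properties using (≡-dec)
open import Data.Vec as Vec using (Vec; []; _∷_; lookup; tabulate)
open import Data.Vec.Membership.Propositional using () renaming (_∈_ to _∈ᵥ_)
open import Data.Vec.Properties using (lookup∘tabulate)
import Data.Vec.Relation.Unary.Any as VecAny
import Data.Vec.Relation.Unary.Any.Properties as VecAny
open import Data.Vec.Relation.Unary.AllPairs using (allPairs?)
open import Data.Vec.Relation.Unary.Unique.Propositional using (Unique)
open import Data.Vec.Relation.Unary.Unique.Propositional.Properties using (lookup-injective)
open import Function using (_∘_)
open import Function.Bundles using (Equivalence; mk↔ₛ′)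
open import Relation.Nullary using (Dec; yes; no; does; ¬?; ⌊_⌋)
open import Relation.Nullary.Decidable using (map′; dec-true; from-yes; toWitness; _×-dec_; _→-dec_)
open import Relation.Binary.PropositionalEquality

Adjacency : ℕ → Set
Adjacency n = Fin n → Fin n → Bool

-- The first row records the adjacency of vertex zero to the later vertices.
data UpperTriangle : ℕ → Set where
  []  : UpperTriangle zero
  _∷_ : ∀ {n} → Vec Bool n → UpperTriangle n → UpperTriangle (suc n)

adjacency : ∀ {n} → UpperTriangle n → Adjacency n
adjacency (r ∷ t) zero    zero    = false
adjacency (r ∷ t) zero    (suc j) = lookup r j
adjacency (r ∷ t) (suc i) zero    = lookup r i
adjacency (r ∷ t) (suc i) (suc j) = adjacency t i j

deleteZero : ∀ {n} → SimpleGraph (suc n) → SimpleGraph n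
deleteZero G = record
  { adj    = λ i j → adj G (suc i) (suc j)
  ; sym    = λ i j → SimpleGraph.sym G (suc i) (suc j)
  ; irrefl = irrefl G ∘ suc
  }

toTriangle : ∀ {n} → SimpleGraph n → UpperTriangle n
toTriangle {zero}  G = []
toTriangle {suc n} G = tabulate (adj G zero ∘ suc) ∷ toTriangle (deleteZero G)

adjacency-toTriangle : ∀ {n} (G : SimpleGraph n) i j → adjacency (toTriangle G) i j ≡ adj G i j
adjacency-toTriangle G zero    zero    = sym (irrefl G zero)
adjacency-toTriangle G zero    (suc j) = lookup∘tabulate (adj G zero ∘ suc) j
adjacency-toTriangle G (suc i) zero    =
  trans (lookup∘tabulate (adj G zero ∘ suc) i) (SimpleGraph.sym G zero (suc i))
adjacency-toTriangle G (suc i) (suc j) = adjacency-toTriangle (deleteZero G) i j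

indicator : Bool → ℕ
indicator b = if b then 1 else 0

degreeIn : ∀ {n} → Adjacency n → Fin n → ℕ
degreeIn A u = sum (List.tabulate (indicator ∘ A u))

degreeIn≡degree : ∀ {n} (G : SimpleGraph n) {A : Adjacency n} →
  (∀ i j → A i j ≡ adj G i j) → ∀ u → degreeIn A u ≡ degree G u
degreeIn≡degree G A≗G u = cong sum (sym (trans (map-tabulate (λ v → v) (indicator ∘ adj G u))
                                               (tabulate-cong (cong indicator ∘ sym ∘ A≗G u))))

allRows : ∀ n → (Vec Bool n → Bool) → Bool
allRows zero    P = P []
allRows (suc n) P = allRows n (P ∘ (false ∷_)) ∧ allRows n (P ∘ (true ∷_))

∧≡true : ∀ {a b} → a ∧ b ≡ true → a ≡ true × b ≡ true
∧≡true {true}  {true}  _  = refl , refl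
∧≡true {true}  {false} ()
∧≡true {false}         ()

allRows-sound : ∀ n P → allRows n P ≡ true → ∀ r → P r ≡ true
allRows-sound zero    P ok []          = ok
allRows-sound (suc n) P ok (false ∷ r) = allRows-sound n _ (proj₁ (∧≡true ok)) r
allRows-sound (suc n) P ok (true ∷ r)  = allRows-sound n _ (proj₂ (∧≡true ok)) r

rowDegree : ∀ {n} → Vec Bool n → ℕ
rowDegree r = sum (List.tabulate (indicator ∘ lookup r))

-- Rows failing this test cannot start a triangle with degree sequence ds and are pruned.
RowFits : ∀ {n} → (Fin (suc n) → ℕ) → Vec Bool n → Set
RowFits ds r = rowDegree r ≡ ds zero × (∀ j → indicator (lookup r j) ≤ ds (suc j))

rowFits? : ∀ {n} ds (r : Vec Bool n) → Dec (RowFits ds r)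
rowFits? ds r = rowDegree r ≟ ds zero ×-dec all? (λ j → indicator (lookup r j) ≤? ds (suc j))

remaining : ∀ {n} → (Fin (suc n) → ℕ) → Vec Bool n → Fin n → ℕ
remaining ds r j = ds (suc j) ∸ indicator (lookup r j)

allWithDegrees : ∀ {n} → (Fin n → ℕ) → (UpperTriangle n → Bool) → Bool
allWithDegrees {zero}  ds P = P []
allWithDegrees {suc n} ds P = allRows n λ r →
  if does (rowFits? ds r) then allWithDegrees (remaining ds r) (P ∘ (r ∷_)) else true

allWithDegrees-sound : ∀ {n} (ds : Fin n → ℕ) P → allWithDegrees ds P ≡ true →
  ∀ t → (∀ u → degreeIn (adjacency t) u ≡ ds u) → P t ≡ true
allWithDegrees-sound {zero}  ds P ok []      degrees = ok
allWithDegrees-sound {suc n} ds P ok (r ∷ t) degrees =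
  allWithDegrees-sound (remaining ds r) (P ∘ (r ∷_)) rest t degrees′
  where
  fits : RowFits ds r
  fits = degrees zero , λ j → subst (_ ≤_) (degrees (suc j)) (m≤m+n _ _)

  rest : allWithDegrees (remaining ds r) (P ∘ (r ∷_)) ≡ true
  rest = subst (λ b → (if b then allWithDegrees (remaining ds r) (P ∘ (r ∷_)) else true) ≡ true)
               (dec-true (rowFits? ds r) fits) (allRows-sound n _ ok r)

  degrees′ : ∀ j → degreeIn (adjacency t) j ≡ remaining ds r j
  degrees′ j = sym (trans (cong (_∸ indicator (lookup r j)) (sym (degrees (suc j))))
                          (m+n∸m≡n (indicator (lookup r j)) _))

allVectors? : ∀ {k} m {P : Vec (Fin k) m → Set} → (∀ v → Dec (P v)) → Dec (∀ v → P v)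
allVectors? zero    P? = map′ (λ p → λ { [] → p }) (λ ∀P → ∀P []) (P? [])
allVectors? (suc m) P? = map′ (λ ∀P → λ { (x ∷ v) → ∀P x v }) (λ ∀P x v → ∀P (x ∷ v))
                              (all? λ x → allVectors? m (P? ∘ (x ∷_)))

-- hub # 0, rim # 1 … # 5
wheel₅ : List (Fin 6 × Fin 6)
wheel₅ = (# 0 , # 1) ∷ (# 0 , # 2) ∷ (# 0 , # 3) ∷ (# 0 , # 4) ∷ (# 0 , # 5) ∷
         (# 1 , # 2) ∷ (# 2 , # 3) ∷ (# 3 , # 4) ∷ (# 4 , # 5) ∷ (# 5 , # 1) ∷ []

wheel₅-not-3-colorable : ∀ (c : Vec (Fin 3) 6) → Any (λ (a , b) → lookup c a ≡ lookup c b) wheel₅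
wheel₅-not-3-colorable =
  from-yes (allVectors? {3} 6 λ c → any? (λ (a , b) → lookup c a Fin.≟ lookup c b) wheel₅)

WheelHom : ∀ {n} → Adjacency n → (Fin 6 → Fin n) → Set
WheelHom A w = All (λ (a , b) → A (w a) (w b) ≡ true) wheel₅

wheelHom⇒4≤colors : ∀ {n} (G : SimpleGraph n) {w} → WheelHom (adj G) w →
  ∀ {m} → Colorable G m → 4 ≤ m
wheelHom⇒4≤colors G {w} hom {m} (c , proper) with 4 ≤? m
... | yes 4≤m = 4≤m
... | no  4≰m = ⊥-elim (All¬⇒¬Any (All.map (λ {(a , b)} → distinct a b) hom)
                                  (wheel₅-not-3-colorable c₃))
  where
  m≤3 : m ≤ 3
  m≤3 = ≤-pred (≰⇒> 4≰m)

  color₃ : Fin 6 → Fin 3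
  color₃ a = inject≤ (c (w a)) m≤3

  c₃ : Vec (Fin 3) 6
  c₃ = tabulate color₃

  distinct : ∀ a b → adj G (w a) (w b) ≡ true → lookup c₃ a ≢ lookup c₃ b
  distinct a b ab same = proper (w a) (w b) ab (inject≤-injective m≤3 m≤3 _ _
    (trans (sym (lookup∘tabulate color₃ a)) (trans same (lookup∘tabulate color₃ b))))

Separates : ∀ {n} → Adjacency n → (Fin n → ℕ) → Set
Separates A s = ∀ u v → A u v ≡ true → s u ≢ s v

separates? : ∀ {n} (A : Adjacency n) s → Dec (Separates A s)
separates? A s = all? λ u → all? λ v → A u v Bool.≟ true →-dec ¬? (s u ≟ s v)

separates-cong : ∀ {n} {A : Adjacency n} {s s′} → (∀ u → s u ≡ s′ u) → Separates A s → Separates A s′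
separates-cong s≗s′ separates u v uv = separates u v uv ∘ subst₂ _≡_ (sym (s≗s′ u)) (sym (s≗s′ v))

distinctValues : ∀ {n} → (Fin n → ℕ) → ℕ
distinctValues {n} s = length (deduplicate _≟_ (List.map s (allFin n)))

separates⇒colorable : ∀ {n} (G : SimpleGraph n) {s} → Separates (adj G) s → Colorable G (distinctValues s)
separates⇒colorable {n} G {s} separates = color , λ u v uv same → separates u v uv (values-agree u v same)
  where
  values : List ℕ
  values = deduplicate _≟_ (List.map s (allFin n))

  value∈values : ∀ u → s u ∈ values
  value∈values u = ∈-deduplicate⁺ _≟_ (∈-map⁺ s (∈-allFin u))

  color : Fin n → Fin (length values)
  color u = Any.index (value∈values u)

  values-agree : ∀ u v → color u ≡ color v → s u ≡ s v
  values-agree u v same = trans (Any.lookup-index (value∈values u))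
    (trans (cong (List.lookup values) same) (sym (Any.lookup-index (value∈values v))))

χla≡χ≡4 : ∀ {n} (G : SimpleGraph n) (f : EdgeLabeling G) → IsLocalAntimagic G f →
  numColors G f ≡ 4 → ∀ {w} → WheelHom (adj G) w →
  IsLocalAntimagicChromaticNumber G 4 × IsChromaticNumber G 4
χla≡χ≡4 G f antimagic four wheelHom =
  ((f , antimagic , four) , λ g g-antimagic → atLeast4 (separates⇒colorable G g-antimagic)) ,
  (subst (Colorable G) four (separates⇒colorable G antimagic) , λ _ → atLeast4)
  where
  atLeast4 : ∀ {m} → Colorable G m → 4 ≤ m
  atLeast4 = wheelHom⇒4≤colors G wheelHom

IsEdgeIn : ∀ {n} → Adjacency n → Fin n × Fin n → Set
IsEdgeIn A (i , j) = i < j × A i j ≡ true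

isEdgeIn? : ∀ {n} (A : Adjacency n) p → Dec (IsEdgeIn A p)
isEdgeIn? A (i , j) = i <? j ×-dec A i j Bool.≟ true

record EnumeratesEdges {n q} (A : Adjacency n) (es : Vec (Fin n × Fin n) q) : Set where
  constructor enumerates
  field
    isEdge : ∀ k → IsEdgeIn A (lookup es k)
    covers : ∀ i j → IsEdgeIn A (i , j) → (i , j) ∈ᵥ es
    unique : Unique es

enumeratesEdges? : ∀ {n q} (A : Adjacency n) (es : Vec (Fin n × Fin n) q) → Dec (EnumeratesEdges A es)
enumeratesEdges? A es = map′ (λ (e , c , u) → enumerates e c u) (λ (enumerates e c u) → e , c , u) (
  all? (isEdgeIn? A ∘ lookup es) ×-dec
  all? (λ i → all? λ j → isEdgeIn? A (i , j) →-dec VecAny.any? ((i , j) ≟ₚ_) es) ×-dec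
  allPairs? (λ p p′ → ¬? (p ≟ₚ p′)) es)
  where _≟ₚ_ = ≡-dec Fin._≟_ Fin._≟_

edge-≡ : ∀ {n} (G : SimpleGraph n) {e e′ : Edge G} → proj₁ e ≡ proj₁ e′ → e ≡ e′
edge-≡ G {_ , i<j , ij} {_ , i<j′ , ij′} refl =
  cong₂ (λ x y → _ , x , y) (<-irrelevant i<j i<j′) (Decidable⇒UIP.≡-irrelevant Bool._≟_ ij ij′)

module _ {n} (G : SimpleGraph n) {q} {es : Vec (Fin n × Fin n) q} (enum : EnumeratesEdges (adj G) es) where
  open EnumeratesEdges enum

  private
    edgeAt : Fin q → Edge G
    edgeAt k = lookup es k , isEdge k

    position : (e : Edge G) → proj₁ e ∈ᵥ es
    position ((i , j) , ij) = covers i j ij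

    indexOf : Edge G → Fin q
    indexOf e = VecAny.index (position e)

    indexOf-edgeAt : ∀ k → indexOf (edgeAt k) ≡ k
    indexOf-edgeAt k = lookup-injective unique _ _
      (sym (VecAny.lookup-index (position (edgeAt k))))

    edgeAt-indexOf : ∀ e → edgeAt (indexOf e) ≡ e
    edgeAt-indexOf e = edge-≡ G (sym (VecAny.lookup-index (position e)))

  labelingOf : EdgeLabeling G
  labelingOf = record { q = q ; bij = mk↔ₛ′ indexOf edgeAt indexOf-edgeAt edgeAt-indexOf }

incident : ∀ {n} → Fin n → Fin n × Fin n → Bool
incident u (i , j) = ⌊ u Fin.≟ i ⌋ ∨ ⌊ u Fin.≟ j ⌋

-- Definitionally equal to vsum (labelingOf G enum), the k-th entry of es carrying label k + 1.
labelSum : ∀ {n q} → Vec (Fin n × Fin n) q → Fin n → ℕ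
labelSum {q = q} es u = sum (List.map (λ k → if incident u (lookup es k) then suc (toℕ k) else 0) (allFin q))

record Certificate (n q : ℕ) : Set where
  field
    edges : Vec (Fin n × Fin n) q
    wheel : Vec (Fin n) 6
open Certificate

record Valid {n q} (A : Adjacency n) (c : Certificate n q) : Set where
  constructor valid
  field
    enumeration : EnumeratesEdges A (edges c)
    antimagic   : Separates A (labelSum (edges c))
    fourSums    : distinctValues (labelSum (edges c)) ≡ 4
    wheelHom    : WheelHom A (lookup (wheel c))

valid? : ∀ {n q} (A : Adjacency n) (c : Certificate n q) → Dec (Valid A c)
valid? {n} A c = map′ (λ (e , a , s , w) → valid e a s w) (λ (valid e a s w) → e , a , s , w) (
  enumeratesEdges? A (edges c) ×-dec
  -- The sums are tabulated so that the evaluator computes each of them only once.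
  map′ (separates-cong (lookup∘tabulate sums)) (separates-cong (sym ∘ lookup∘tabulate sums))
       (separates? A (lookup (tabulate sums))) ×-dec
  distinctValues (labelSum (edges c)) ≟ 4 ×-dec
  All.all? (λ (a , b) → A (lookup (wheel c) a) (lookup (wheel c) b) Bool.≟ true) wheel₅)
  where
  sums : Fin n → ℕ
  sums = labelSum (edges c)

valid-sound : ∀ {n q} (A : Adjacency n) (c : Certificate n q) → ⌊ valid? A c ⌋ ≡ true → Valid A c
valid-sound A c = toWitness ∘ Equivalence.from T-≡

valid-cong : ∀ {n q} {A B : Adjacency n} {c : Certificate n q} →
  (∀ i j → A i j ≡ B i j) → Valid A c → Valid B c
valid-cong {A = A} {B} A≗B (valid (enumerates isEdge covers unique) antimagic four wheelHom) =
  valid (enumerates (edgeInB ∘ isEdge) (λ i j → covers i j ∘ edgeInA) unique)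
        (λ u v → antimagic u v ∘ inA u v) four (All.map (inB _ _) wheelHom)
  where
  inB : ∀ i j → A i j ≡ true → B i j ≡ true
  inB i j = trans (sym (A≗B i j))

  inA : ∀ i j → B i j ≡ true → A i j ≡ true
  inA i j = trans (A≗B i j)

  edgeInB : ∀ {p} → IsEdgeIn A p → IsEdgeIn B p
  edgeInB (i<j , ij) = i<j , inB _ _ ij

  edgeInA : ∀ {p} → IsEdgeIn B p → IsEdgeIn A p
  edgeInA (i<j , ij) = i<j , inA _ _ ij

valid⇒χla≡χ≡4 : ∀ {n q} (G : SimpleGraph n) (c : Certificate n q) → Valid (adj G) c →
  IsLocalAntimagicChromaticNumber G 4 × IsChromaticNumber G 4
valid⇒χla≡χ≡4 G c (valid enum antimagic four wheelHom) =
  χla≡χ≡4 G (labelingOf G enum) antimagic four wheelHom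

module ComplementCycle {n} (A : Adjacency n) where

  coNeighbours : Fin n → List (Fin n)
  coNeighbours v = filterᵇ (λ u → not (A v u ∨ ⌊ u Fin.≟ v ⌋)) (allFin n)

  next : Fin n → Fin n → Fin n
  next previous current =
    fromMaybe current (head (filterᵇ (λ u → not ⌊ u Fin.≟ previous ⌋) (coNeighbours current)))

  cycleThrough : Fin n → List (Fin n)
  cycleThrough s = s ∷ walk n s (next s s)
    where
    walk : ℕ → Fin n → Fin n → List (Fin n)
    walk zero    previous current = []
    walk (suc k) previous current =
      if ⌊ current Fin.≟ s ⌋ then [] else current ∷ walk k current (next previous current)

relabel : ∀ {n q} → (Fin n → Fin n) → Certificate n q → Certificate n q
relabel {n} π c = record
  { edges = Vec.map (λ (i , j) → orient (π i) (π j)) (edges c)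
  ; wheel = Vec.map π (wheel c)
  }
  where
  orient : Fin n → Fin n → Fin n × Fin n
  orient a b = if ⌊ a <? b ⌋ then (a , b) else (b , a)

-- Templates for the complements of the cycles (0 1 … 7), (0 1 2)(3 4 5 6 7) and (0 1 2 3)(4 5 6 7).
-- The first and last map W₅ onto the K₄ on {0, 2, 4, 6}.
complementOfC₈ complementOfC₃+C₅ complementOfC₄+C₄ : Certificate 8 20
complementOfC₈ = record
  { edges = (# 5 , # 7) ∷ (# 1 , # 3) ∷ (# 1 , # 5) ∷ (# 0 , # 4) ∷ (# 0 , # 3) ∷
            (# 2 , # 4) ∷ (# 2 , # 6) ∷ (# 2 , # 7) ∷ (# 0 , # 6) ∷ (# 4 , # 6) ∷
            (# 4 , # 7) ∷ (# 3 , # 5) ∷ (# 1 , # 6) ∷ (# 2 , # 5) ∷ (# 1 , # 4) ∷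
            (# 0 , # 5) ∷ (# 3 , # 7) ∷ (# 3 , # 6) ∷ (# 0 , # 2) ∷ (# 1 , # 7) ∷ []
  ; wheel = # 0 ∷ # 2 ∷ # 4 ∷ # 2 ∷ # 4 ∷ # 6 ∷ []
  }
complementOfC₃+C₅ = record
  { edges = (# 2 , # 3) ∷ (# 1 , # 4) ∷ (# 0 , # 7) ∷ (# 2 , # 6) ∷ (# 0 , # 5) ∷
            (# 1 , # 3) ∷ (# 5 , # 7) ∷ (# 4 , # 6) ∷ (# 2 , # 4) ∷ (# 1 , # 7) ∷
            (# 3 , # 5) ∷ (# 0 , # 3) ∷ (# 4 , # 7) ∷ (# 1 , # 6) ∷ (# 0 , # 6) ∷
            (# 0 , # 4) ∷ (# 2 , # 5) ∷ (# 3 , # 6) ∷ (# 1 , # 5) ∷ (# 2 , # 7) ∷ []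
  ; wheel = # 0 ∷ # 3 ∷ # 5 ∷ # 7 ∷ # 4 ∷ # 6 ∷ []
  }
complementOfC₄+C₄ = record
  { edges = (# 2 , # 6) ∷ (# 1 , # 5) ∷ (# 2 , # 5) ∷ (# 1 , # 3) ∷ (# 0 , # 4) ∷
            (# 2 , # 7) ∷ (# 0 , # 7) ∷ (# 3 , # 4) ∷ (# 3 , # 6) ∷ (# 1 , # 7) ∷
            (# 0 , # 6) ∷ (# 1 , # 6) ∷ (# 0 , # 5) ∷ (# 3 , # 5) ∷ (# 2 , # 4) ∷
            (# 1 , # 4) ∷ (# 4 , # 6) ∷ (# 5 , # 7) ∷ (# 0 , # 2) ∷ (# 3 , # 7) ∷ []
  ; wheel = # 0 ∷ # 2 ∷ # 4 ∷ # 2 ∷ # 4 ∷ # 6 ∷ []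
  }

-- The cycles of the complement through zero and through the first vertex the former misses,
-- shorter first (for C₈ both are the whole cycle).
complementCycles : Adjacency 8 → List (Fin 8) × List (Fin 8)
complementCycles A = if length c₁ ≤ᵇ length c₂ then (c₁ , c₂) else (c₂ , c₁)
  where
  open ComplementCycle A
  c₁ c₂ : List (Fin 8)
  c₁ = cycleThrough zero
  c₂ = cycleThrough (fromMaybe zero (head (filter (_∉? c₁) (allFin 8))))

-- Separate from complementCycles so that the evaluator shares the cycles between all lookups.
certificateFromCycles : List (Fin 8) × List (Fin 8) → Certificate 8 20
certificateFromCycles (c₁ , c₂) = relabel (position (c₁ ++ c₂)) (byShorterCycle (length c₁))
  where
  position : List (Fin 8) → Fin 8 → Fin 8
  position order i = fromMaybe zero (head (drop (toℕ i) order))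

  byShorterCycle : ℕ → Certificate 8 20
  byShorterCycle 3 = complementOfC₃+C₅
  byShorterCycle 4 = complementOfC₄+C₄
  byShorterCycle _ = complementOfC₈

certificateFor : Adjacency 8 → Certificate 8 20
certificateFor = certificateFromCycles ∘ complementCycles

-- The predicate is spelled out identically here and in certificateFor-valid: a conversion that
-- has to unfold it would evaluate valid? on an abstract triangle.
all-certified :
  allWithDegrees (λ _ → 5) (λ t → ⌊ valid? (adjacency t) (certificateFor (adjacency t)) ⌋) ≡ true
all-certified = refl

certificateFor-valid : ∀ t → (∀ u → degreeIn (adjacency t) u ≡ 5) →
  Valid (adjacency t) (certificateFor (adjacency t))
certificateFor-valid t degrees = valid-sound (adjacency t) (certificateFor (adjacency t))
  (allWithDegrees-sound (λ _ → 5) (λ t → ⌊ valid? (adjacency t) (certificateFor (adjacency t)) ⌋)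
                        all-certified t degrees)

theorem2p6 : (G : SimpleGraph 8) → Regular G 5 →
    IsLocalAntimagicChromaticNumber G 4 × IsChromaticNumber G 4
theorem2p6 G regular =
  valid⇒χla≡χ≡4 G _ (valid-cong (adjacency-toTriangle G) (certificateFor-valid (toTriangle G) λ u →
    trans (degreeIn≡degree G (adjacency-toTriangle G) u) (regular u)))
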